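{- For any Helly graph $G$ the following statements are equivalent: (i) $G$ is $\frac12$-hyperbolic (i.e., $hb(G)\le \frac12$); (ii) $G$ has neither $C_4$ nor $S_4$ as an isometric subgraph; (iii) neither $G$ nor $G^2$ has an induced $C_4$; (iv) $\tau(G)\le 1$ and $G$ has no $S_4$ as an isometric subgraph.
   Context: Graphs are finite, connected, unweighted, undirected and simple; $d$ is the shortest-path distance. A subgraph is isometric if it is induced and distance-preserving. A graph is Helly if every family of pairwise intersecting disks $D(v,r)=\{u:d(u,v)\le r\}$ has a common vertex. $hb(G)$ is the maximum over quadruples $u,v,w,x$ of one half of the difference between the two largest of $d(u,v)+d(w,x)$, $d(u,w)+d(v,x)$, $d(u,x)+d(v,w)$. $G^2$ is the graph on $V(G)$ with $uv$ an edge iff $0<d(u,v)\le 2$. $C_4$ is the cycle on four vertices. $S_4$ (the 4-sun) is the graph on eight vertices $p_1,p_2,p_3,p_4,q_1,q_2,q_3,q_4$ in which $p_1,\dots,p_4$ form a clique and each $q_i$ is adjacent exactly to $p_i$ and $p_{i+1}$ (indices mod 4). $I(x,y)=\{z: d(x,z)+d(z,y)=d(x,y)\}$, $S_j(x,y)=\{z\in I(x,y): d(x,z)=j\}$, $\tau(G)=\max\{d(u,v): u,v\in S_j(x,y),\ x,y\in V(G),\ j\in\mathbb{N}\}$. -}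

module Defs where

open import Data.Nat using (ℕ; zero; suc; _≤_; _<_; _+_; _∸_; _⊔_; _⊓_)
open import Data.Nat.Properties using (_≤?_)
open import Data.Fin using (Fin; zero; suc; _≟_)
open import Data.Bool using (Bool; true; false; _∧_; _∨_; if_then_else_; not)
open import Data.List using (List; []; _∷_; map; allFin; foldr; concatMap)
open import Data.Bool.ListAction using (any)
open import Data.Product using (Σ; ∃; _×_; _,_)
open import Relation.Binary.PropositionalEquality using (_≡_)
open import Relation.Nullary using (¬_; does)

record Graph : Set where
  constructor mkGraph
  field
    n   : ℕ
    adj : Fin n → Fin n → Bool

open Graph public

V : Graph → Set
V G = Fin (n G)

Simple : Graph → Set
Simple G = (∀ u v → adj G u v ≡ adj G v u) × (∀ u → adj G u u ≡ false)

data Walk (G : Graph) : V G → V G → ℕ → Set where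
  [] : ∀ {u} → Walk G u u 0
  step : ∀ {u w v k} → adj G u w ≡ true → Walk G w v k → Walk G u v (suc k)

Connected : Graph → Set
Connected G = ∀ (u v : V G) → ∃ λ k → Walk G u v k

anyV : (G : Graph) → (V G → Bool) → Bool
anyV G p = any p (allFin (n G))

reach : (G : Graph) → ℕ → V G → V G → Bool
reach G zero u v = does (u ≟ v)
reach G (suc k) u v = reach G k u v ∨ anyV G (λ w → reach G k u w ∧ adj G w v)

search : (ℕ → Bool) → ℕ → ℕ → ℕ
search p k zero = k
search p k (suc f) = if p k then k else search p (suc k) f

-- d(u,v) = least k such that v is reachable from u by a walk of length ≤ k
-- (in a connected graph on n vertices this least k is < n)
dist : (G : Graph) → V G → V G → ℕ
dist G u v = search (λ k → reach G k u v) 0 (n G)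

D : (G : Graph) → V G → ℕ → V G → Set
D G v r u = dist G u v ≤ r

Helly : Graph → Set
Helly G = ∀ (m : ℕ) (c : Fin m → V G) (r : Fin m → ℕ) →
  (∀ i j → ∃ λ w → D G (c i) (r i) w × D G (c j) (r j) w) →
  ∃ λ w → ∀ i → D G (c i) (r i) w

maxOver : {A : Set} → List A → (A → ℕ) → ℕ
maxOver xs f = foldr (λ x acc → f x ⊔ acc) 0 xs

quads : (G : Graph) → List (V G × V G × V G × V G)
quads G = concatMap (λ u → concatMap (λ v → concatMap (λ w → map (λ x → (u , v , w , x))
            (allFin (n G))) (allFin (n G))) (allFin (n G))) (allFin (n G))

-- difference between the largest and the second largest of three numbers
max3 : ℕ → ℕ → ℕ → ℕ
max3 a b c = a ⊔ b ⊔ c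

median3 : ℕ → ℕ → ℕ → ℕ
median3 a b c = (a ⊓ b) ⊔ ((a ⊔ b) ⊓ c)

top2diff : ℕ → ℕ → ℕ → ℕ
top2diff a b c = max3 a b c ∸ median3 a b c

-- twoHb G = 2 · hb(G)  (hb(G) is a half-integer, so we work with 2·hb in ℕ)
twoHb : Graph → ℕ
twoHb G = maxOver (quads G) λ where
  (u , v , w , x) → top2diff (dist G u v + dist G w x)
                             (dist G u w + dist G v x)
                             (dist G u x + dist G v w)

HalfHyperbolic : Graph → Set
HalfHyperbolic G = twoHb G ≤ 1

InI : (G : Graph) → V G → V G → V G → Set
InI G x y z = dist G x z + dist G z y ≡ dist G x y

InS : (G : Graph) → ℕ → V G → V G → V G → Set
InS G j x y z = InI G x y z × dist G x z ≡ j

-- τ(G) = max { d(u,v) : u,v ∈ S_j(x,y) }; for u,v ∈ I(x,y), u,v lie in a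
-- common slice S_j(x,y) iff d(x,u) = d(x,v).
tau : Graph → ℕ
tau G = maxOver (quads G) λ where
  (x , y , u , v) →
    if does (dist G x u + dist G u y Data.Nat.≟ dist G x y)
       ∧ does (dist G x v + dist G v y Data.Nat.≟ dist G x y)
       ∧ does (dist G x u Data.Nat.≟ dist G x v)
    then dist G u v else 0

sqAdj : (G : Graph) → V G → V G → Bool
sqAdj G u v = does (1 ≤? dist G u v) ∧ does (dist G u v ≤? 2)

c4adj : Fin 4 → Fin 4 → Bool
c4adj zero (suc zero) = true
c4adj (suc zero) (suc (suc zero)) = true
c4adj (suc (suc zero)) (suc (suc (suc zero))) = true
c4adj (suc (suc (suc zero))) zero = true
c4adj (suc zero) zero = true
c4adj (suc (suc zero)) (suc zero) = true
c4adj (suc (suc (suc zero))) (suc (suc zero)) = true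
c4adj zero (suc (suc (suc zero))) = true
c4adj _ _ = false

C4 : Graph
C4 = mkGraph 4 c4adj

-- vertices 0,1,2,3 = p₁..p₄ ; 4,5,6,7 = q₁..q₄ with qᵢ ~ pᵢ, pᵢ₊₁
s4e : Fin 8 → Fin 8 → Bool
-- the p's form a clique
s4e zero (suc zero) = true
s4e zero (suc (suc zero)) = true
s4e zero (suc (suc (suc zero))) = true
s4e (suc zero) (suc (suc zero)) = true
s4e (suc zero) (suc (suc (suc zero))) = true
s4e (suc (suc zero)) (suc (suc (suc zero))) = true
s4e zero (suc (suc (suc (suc zero)))) = true
s4e (suc zero) (suc (suc (suc (suc zero)))) = true
s4e (suc zero) (suc (suc (suc (suc (suc zero))))) = true
s4e (suc (suc zero)) (suc (suc (suc (suc (suc zero))))) = true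
s4e (suc (suc zero)) (suc (suc (suc (suc (suc (suc zero)))))) = true
s4e (suc (suc (suc zero))) (suc (suc (suc (suc (suc (suc zero)))))) = true
s4e (suc (suc (suc zero))) (suc (suc (suc (suc (suc (suc (suc zero))))))) = true
s4e zero (suc (suc (suc (suc (suc (suc (suc zero))))))) = true
s4e _ _ = false

S4 : Graph
S4 = mkGraph 8 (λ u v → s4e u v ∨ s4e v u)

-- H is (isomorphic to) an isometric subgraph of G: a distance-preserving
-- (hence injective and induced) embedding of H into G
IsometricSubgraph : Graph → Graph → Set
IsometricSubgraph H G =
  Σ (V H → V G) λ φ → ∀ a b → dist G (φ a) (φ b) ≡ dist H a b

HasInducedC4 : {m : ℕ} → (Fin m → Fin m → Bool) → Set
HasInducedC4 {m} e =
  Σ (Fin 4 → Fin m) λ φ → (∀ a b → φ a ≡ φ b → a ≡ b) × (∀ a b → e (φ a) (φ b) ≡ c4adj a b)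

-- Call a quadruple u, w, v, x violating if d(u,v) + d(w,x) exceeds both
-- d(u,w) + d(v,x) and d(w,v) + d(x,u) by at least 2; hb(G) ≤ ½ says exactly that
-- none exists. Take a violating quadruple with d(u,v) + d(w,x) minimal. Unless its
-- distances are those of C4 (sides 1, diagonals 2) or of the outer cycle of S4
-- (sides 2, diagonals 3), a case analysis on the six distances produces, for one
-- of its vertices (say u), pairwise intersecting disks D(u,1), D(v,d(u,v) − 1),
-- D(w,ρ), D(x,ρ′); a common point, given by the Helly property, replaces u and
-- keeps the quadruple violating with a shorter diagonal. In the S4 case, four more
-- Helly applications build the inner clique. Conversely isometric C4 and S4,
-- induced C4 in G or G², and two vertices at distance 2 in a common slice all give
-- violating quadruples, while an isometric C4 forces τ(G) ≥ 2.

module Submission where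

open import Defs
open import Data.Bool using (Bool; true; false; T; _∧_; if_then_else_)
open import Data.Bool.Properties using (T-∨; T-∧; T-≡)
import Data.Bool.Properties as Boolₚ
open import Data.Empty using (⊥; ⊥-elim)
open import Data.Fin using (Fin; zero; suc; _≟_; #_) renaming (_<_ to _<ᶠ_)
open import Data.Fin.Properties using (injective⇒≤; all?) renaming (<-cmp to <-cmpᶠ)
open import Data.List using (List; []; _∷_; _++_; map; length; lookup; tabulate; allFin)
open import Data.List.Membership.Propositional using (_∈_; lose)
open import Data.List.Membership.Propositional.Properties using (∈-lookup; ∈-allFin; ∈-map⁺; ∈-concatMap⁺)
open import Data.List.Membership.DecPropositional using (_∈?_)
open import Data.List.Relation.Unary.All as All using (All)
open import Data.List.Relation.Unary.All.Properties using (¬Any⇒All¬; tabulate⁻; All-swap; ++⁻)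
import Data.List.Relation.Unary.All.Properties as Allₚ
open import Data.List.Relation.Unary.AllPairs using (AllPairs; []; _∷_)
import Data.List.Relation.Unary.AllPairs.Properties as AllPairsₚ
open import Data.List.Relation.Unary.Any using (here; there; satisfied; index)
open import Data.List.Relation.Unary.Any.Properties using (any⁺; any⁻; lookup-index)
open import Data.List.Relation.Unary.Unique.Propositional using (Unique)
open import Data.Nat using (ℕ; zero; suc; _≤_; _<_; _+_; _∸_; _⊔_; _⊓_; _<ᵇ_; _≤ᵇ_; z≤n; s≤s)
open import Data.Nat.Properties hiding (_≟_)
import Data.Nat.Properties as ℕₚ
open import Data.Nat.Tactic.RingSolver using (solve)
open import Data.Product using (Σ; ∃; _×_; _,_; proj₁; proj₂)
open import Data.Sum using (_⊎_; inj₁; inj₂; [_,_])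
open import Function using (_∘_; case_of_)
open import Function.Bundles using (_⇔_; mk⇔; Equivalence)
open import Relation.Binary.Definitions using (tri<; tri≈; tri>)
open import Relation.Binary.PropositionalEquality hiding ([_])
open import Relation.Nullary using (¬_; yes; no; does)
open import Relation.Nullary.Decidable using (dec-true; dec-false; from-yes; _→-dec_)
open ≡-Reasoning

lookup-injective : ∀ {A : Set} {xs : List A} → Unique xs →
                   ∀ i j → lookup xs i ≡ lookup xs j → i ≡ j
lookup-injective (_ ∷ _) zero zero _ = refl
lookup-injective (x≢xs ∷ _) zero (suc j) e = ⊥-elim (All.lookup x≢xs (∈-lookup j) e)
lookup-injective (x≢xs ∷ _) (suc i) zero e = ⊥-elim (All.lookup x≢xs (∈-lookup i) (sym e))
lookup-injective (_ ∷ u) (suc i) (suc j) e = cong suc (lookup-injective u i j e)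

unique⇒length≤ : ∀ {m} {xs : List (Fin m)} → Unique xs → length xs ≤ m
unique⇒length≤ u = injective⇒≤ (lookup-injective u _ _)

allPairs-tabulate : ∀ {m} {A : Set} {R : A → A → Set} {f : Fin m → A} →
                    AllPairs R (tabulate f) → ∀ {a b} → a <ᶠ b → R (f a) (f b)
allPairs-tabulate (Rf₀ ∷ _) {zero} {suc b} _ = tabulate⁻ Rf₀ b
allPairs-tabulate (_ ∷ Rs) {suc a} {suc b} (s≤s a<b) = allPairs-tabulate Rs a<b

module _ (p : ℕ → Bool) where

  search-minimal : ∀ k f j → k ≤ j → T (p j) → search p k f ≤ j
  search-minimal k zero j k≤j _ = k≤j
  search-minimal k (suc f) j k≤j pj with p k in eq
  ... | true = k≤j
  ... | false = search-minimal (suc k) f j (≤∧≢⇒< k≤j λ { refl → subst T eq pj }) pj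

  search-sound : ∀ k f j → k ≤ j → j < k + f → T (p j) → T (p (search p k f))
  search-sound k zero j k≤j j<k _ = ⊥-elim (<⇒≱ (subst (j <_) (+-identityʳ k) j<k) k≤j)
  search-sound k (suc f) j k≤j j<k+f pj with p k in eq
  ... | true = subst T (sym eq) _
  ... | false = search-sound (suc k) f j (≤∧≢⇒< k≤j λ { refl → subst T eq pj })
                  (subst (j <_) (+-suc k f) j<k+f) pj

module Walks (G : Graph) where

  _++ʷ_ : ∀ {u w v j k} → Walk G u w j → Walk G w v k → Walk G u v (j + k)
  [] ++ʷ W = W
  step e W₁ ++ʷ W = step e (W₁ ++ʷ W)

  snoc : ∀ {u w v k} → Walk G u w k → adj G w v ≡ true → Walk G u v (suc k)
  snoc [] e = step e []
  snoc (step e′ W) e = step e′ (snoc W e)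

  unsnoc : ∀ {u v k} → Walk G u v (suc k) → ∃ λ w → Walk G u w k × adj G w v ≡ true
  unsnoc (step e []) = _ , [] , e
  unsnoc (step e (step e′ W)) with unsnoc (step e′ W)
  ... | w , W′ , e″ = w , step e W′ , e″

  splitʷ : ∀ i {u v k} → i ≤ k → Walk G u v k → ∃ λ z → Walk G u z i × Walk G z v (k ∸ i)
  splitʷ zero _ W = _ , [] , W
  splitʷ (suc i) (s≤s i≤k) (step e W) with splitʷ i i≤k W
  ... | z , W₁ , W₂ = z , step e W₁ , W₂

  reach-sound : ∀ k u v → T (reach G k u v) → ∃ λ j → j ≤ k × Walk G u v j
  reach-sound zero u v r with u ≟ v
  ... | yes refl = 0 , z≤n , []
  reach-sound (suc k) u v r with Equivalence.to T-∨ r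
  ... | inj₁ r′ with reach-sound k u v r′
  ...   | j , j≤k , W = j , m≤n⇒m≤1+n j≤k , W
  reach-sound (suc k) u v r | inj₂ r′ with satisfied (any⁻ _ (allFin (n G)) r′)
  ... | w , rw with Equivalence.to T-∧ rw
  ...   | r₁ , a with reach-sound k u w r₁
  ...     | j , j≤k , W = suc j , s≤s j≤k , snoc W (Equivalence.to T-≡ a)

  reach-complete : ∀ k {u v j} → Walk G u v j → j ≤ k → T (reach G k u v)
  reach-complete zero {u} [] _ = Equivalence.from T-≡ (dec-true (u ≟ u) refl)
  reach-complete (suc k) {u} {v} W j≤1+k with m≤n⇒m<n∨m≡n j≤1+k
  ... | inj₁ (s≤s j≤k) = Equivalence.from T-∨ (inj₁ (reach-complete k W j≤k))
  ... | inj₂ refl with unsnoc W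
  ...   | w , W′ , e = Equivalence.from (T-∨ {reach G k u v}) (inj₂ (any⁺ _ (lose (∈-allFin w)
            (Equivalence.from T-∧ (reach-complete k W′ ≤-refl , Equivalence.from T-≡ e)))))

  dist-≤ : ∀ {u v j} → Walk G u v j → dist G u v ≤ j
  dist-≤ {u} {v} {j} W =
    search-minimal (λ k → reach G k u v) 0 (n G) j z≤n (reach-complete j W ≤-refl)

  dist-refl : ∀ u → dist G u u ≡ 0
  dist-refl u = n≤0⇒n≡0 (dist-≤ {u} [])

  adj⇒dist≤1 : ∀ {u v} → adj G u v ≡ true → dist G u v ≤ 1
  adj⇒dist≤1 a = dist-≤ (step a [])

  vertices : ∀ {u v k} → Walk G u v k → List (V G)
  vertices {u} [] = u ∷ []
  vertices {u} (step _ W) = u ∷ vertices W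

  length-vertices : ∀ {u v k} (W : Walk G u v k) → length (vertices W) ≡ suc k
  length-vertices [] = refl
  length-vertices (step _ W) = cong suc (length-vertices W)

  Path : V G → V G → ℕ → Set
  Path u v k = Σ (Walk G u v k) λ W → Unique (vertices W)

  suffix : ∀ {u v z k} → ((W , _) : Path u v k) → z ∈ vertices W → ∃ λ j → j ≤ k × Path z v j
  suffix ([] , u) (here refl) = 0 , z≤n , [] , u
  suffix (step e W , u) (here refl) = _ , ≤-refl , step e W , u
  suffix (step e W , _ ∷ u) (there z∈W) with suffix (W , u) z∈W
  ... | j , j≤k , P = j , m≤n⇒m≤1+n j≤k , P

  walk⇒path : ∀ {u v k} → Walk G u v k → ∃ λ j → j ≤ k × Path u v j
  walk⇒path [] = 0 , z≤n , [] , All.[] ∷ []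
  walk⇒path {u} (step e W) with walk⇒path W
  ... | j , j≤k , (W′ , uW′) with _∈?_ _≟_ u (vertices W′)
  ...   | yes u∈W′ with suffix (W′ , uW′) u∈W′
  ...     | i , i≤j , P = i , m≤n⇒m≤1+n (≤-trans i≤j j≤k) , P
  walk⇒path {u} (step e W) | j , j≤k , (W′ , uW′) | no u∉W′ =
    suc j , s≤s j≤k , step e W′ , ¬Any⇒All¬ _ u∉W′ ∷ uW′

  path-length< : ∀ {u v k} → Path u v k → k < n G
  path-length< (W , uW) = subst (_≤ n G) (length-vertices W) (unique⇒length≤ uW)

module Metric (G : Graph) (adj-sym : ∀ u v → adj G u v ≡ adj G v u) (conn : Connected G) where
  open Walks G public

  d : V G → V G → ℕ
  d = dist G

  reverseʷ : ∀ {u v k} → Walk G u v k → Walk G v u k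
  reverseʷ [] = []
  reverseʷ {u} (step {w = w} e W) = snoc (reverseʷ W) (trans (adj-sym w u) e)

  -- dist searches only below n G, which suffices since simple paths are shorter.
  geodesic : ∀ u v → Walk G u v (d u v)
  geodesic u v with walk⇒path (proj₂ (conn u v))
  ... | j , _ , P@(W , _) with reach-sound (d u v) u v (search-sound (λ k → reach G k u v) 0 (n G) j
                                   z≤n (path-length< P) (reach-complete j W ≤-refl))
  ...   | i , i≤d , W′ = subst (Walk G u v) (≤-antisym i≤d (dist-≤ W′)) W′

  dist≡0⇒≡ : ∀ {u v} → d u v ≡ 0 → u ≡ v
  dist≡0⇒≡ {u} {v} e with subst (Walk G u v) e (geodesic u v)
  ... | [] = refl

  dist≡1⇒adj : ∀ {u v} → d u v ≡ 1 → adj G u v ≡ true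
  dist≡1⇒adj {u} {v} e with subst (Walk G u v) e (geodesic u v)
  ... | step a [] = a

  dist-sym : ∀ u v → d u v ≡ d v u
  dist-sym u v = ≤-antisym (dist-≤ (reverseʷ (geodesic v u))) (dist-≤ (reverseʷ (geodesic u v)))

  flip≡ : ∀ {u v k} → d u v ≡ k → d v u ≡ k
  flip≡ {u} {v} e = trans (dist-sym v u) e

  flip≤ : ∀ {u v k} → d u v ≤ k → d v u ≤ k
  flip≤ {u} {v} h = subst (_≤ _) (dist-sym u v) h

  dist-triangle : ∀ u w v → d u v ≤ d u w + d w v
  dist-triangle u w v = dist-≤ (geodesic u w ++ʷ geodesic w v)

  triangle-lower : ∀ {y z c} k t → k + t ≤ d y c → d y z ≤ k → t ≤ d z c
  triangle-lower {y} {z} {c} k t k+t≤yc yz≤k = +-cancelˡ-≤ k t (d z c)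
    (≤-trans k+t≤yc (≤-trans (dist-triangle y z c) (+-monoˡ-≤ (d z c) yz≤k)))

  dist-split : ∀ {u v} r s → d u v ≤ r + s → ∃ λ z → d u z ≤ r × d z v ≤ s
  dist-split {u} {v} r s uv≤r+s with d u v ≤? r
  ... | yes uv≤r = v , uv≤r , subst (_≤ s) (sym (dist-refl v)) z≤n
  ... | no uv≰r with splitʷ r (<⇒≤ (≰⇒> uv≰r)) (geodesic u v)
  ...   | z , W₁ , W₂ = z , dist-≤ W₁ , ≤-trans (dist-≤ W₂) (m≤n+o⇒m∸n≤o (d u v) r uv≤r+s)

  isometric-by-pairs : (H : Graph) → (∀ a b → dist H a b ≡ dist H b a) → (φ : V H → V G) →
                       AllPairs (λ a b → d (φ a) (φ b) ≡ dist H a b) (allFin (n H)) →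
                       IsometricSubgraph H G
  isometric-by-pairs H H-sym φ table = φ , iso
    where
    iso : ∀ a b → d (φ a) (φ b) ≡ dist H a b
    iso a b with <-cmpᶠ a b
    ... | tri< a<b _ _ = allPairs-tabulate table a<b
    ... | tri≈ _ refl _ = trans (dist-refl (φ a)) (sym (Walks.dist-refl H a))
    ... | tri> _ _ b<a = trans (flip≡ (allPairs-tabulate table b<a)) (H-sym b a)

-- Linear inequalities are derived as sums h₁ ⊕ h₂ ⊕ … of hypotheses from which a
-- common summand X is cancelled; the ring solver identifies both sides.
cancel-≤ : ∀ {L R L′ R′} X → L′ ≤ R′ → L + X ≡ L′ → R′ ≡ R + X → L ≤ R
cancel-≤ {L} {R} X h e₁ e₂ = +-cancelʳ-≤ X L R (subst₂ _≤_ (sym e₁) e₂ h)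

infixl 6 _⊕_
_⊕_ : ∀ {m n o p} → m ≤ n → o ≤ p → m + o ≤ n + p
_⊕_ = +-mono-≤

-- On numerals the T-arguments of refute and weaken reduce to ⊤ and are written _.
refute : ∀ {m n} → T (n <ᵇ m) → m ≤ n → ⊥
refute {m} {n} t m≤n = <⇒≱ (<ᵇ⇒< n m t) m≤n

weaken : ∀ {x k m} → x ≤ k → T (k ≤ᵇ m) → x ≤ m
weaken {k = k} {m} x≤k t = ≤-trans x≤k (≤ᵇ⇒≤ k m t)

half-positive : ∀ {x} → 2 ≤ x + x → ∃ λ x′ → x ≡ suc x′
half-positive {suc x′} _ = x′ , refl

-- a = d(u,v) and b = d(w,x) are the diagonals and p = d(u,w), q = d(w,v),
-- r = d(v,x), s = d(x,u) the sides of a quadruple u, w, v, x that violates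
-- the ½-hyperbolicity condition with diagonal sum a + b.
record ViolatingQuad (a b p q r s : ℕ) : Set where
  field
    wide₁ : p + r + 2 ≤ a + b
    wide₂ : q + s + 2 ≤ a + b
    b≤p+s : b ≤ p + s
    b≤q+r : b ≤ q + r
    a≤p+q : a ≤ p + q
    a≤r+s : a ≤ r + s
    s≤a+r : s ≤ a + r
    p≤b+s : p ≤ b + s
    q≤a+p : q ≤ a + p
    r≤b+q : r ≤ b + q

rotate : ∀ {a b p q r s} → ViolatingQuad a b p q r s → ViolatingQuad b a q r s p
rotate {a} {b} {p} {q} {r} {s} Q = record
  { wide₁ = subst (q + s + 2 ≤_) (+-comm a b) wide₂
  ; wide₂ = subst₂ _≤_ (cong (_+ 2) (+-comm p r)) (+-comm a b) wide₁
  ; b≤p+s = subst (a ≤_) (+-comm p q) a≤p+q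
  ; b≤q+r = a≤r+s
  ; a≤p+q = b≤q+r
  ; a≤r+s = subst (b ≤_) (+-comm p s) b≤p+s
  ; s≤a+r = p≤b+s ; p≤b+s = q≤a+p ; q≤a+p = r≤b+q ; r≤b+q = s≤a+r }
  where open ViolatingQuad Q

-- Radii for the disks D(u,1), D(v,a′), D(w,ρw), D(x,ρx): the first six fields say
-- that they pairwise intersect, and the last two that a common point u′ again
-- forms a violating quadruple u′, w, v, x, now with d(u′,v) = a′ < a.
record Shift (a b p q r s : ℕ) : Set where
  field
    a′ ρw ρx : ℕ
    a≡1+a′ : a ≡ suc a′
    q≤a′+ρw : q ≤ a′ + ρw
    r≤a′+ρx : r ≤ a′ + ρx
    b≤ρw+ρx : b ≤ ρw + ρx
    p≤1+ρw : p ≤ 1 + ρw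
    s≤1+ρx : s ≤ 1 + ρx
    wide₁′ : ρw + r + 2 ≤ a′ + b
    wide₂′ : q + ρx + 2 ≤ a′ + b

module _ {a b p q r s} (Q : ViolatingQuad a b p q r s) where
  open ViolatingQuad Q

  2≤a+a : 2 ≤ a + a
  2≤a+a = cancel-≤ (p + r + b + s) (wide₁ ⊕ b≤p+s ⊕ s≤a+r)
            (solve (a ∷ b ∷ p ∷ r ∷ s ∷ [])) (solve (a ∷ b ∷ p ∷ r ∷ s ∷ []))

  2≤p+p : 2 ≤ p + p
  2≤p+p = cancel-≤ (q + s + a + b) (wide₂ ⊕ a≤p+q ⊕ b≤p+s)
            (solve (a ∷ b ∷ p ∷ q ∷ s ∷ [])) (solve (a ∷ b ∷ p ∷ q ∷ s ∷ []))

  2≤q+q : 2 ≤ q + q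
  2≤q+q = cancel-≤ (p + r + a + b) (wide₁ ⊕ a≤p+q ⊕ b≤q+r)
            (solve (a ∷ b ∷ p ∷ q ∷ r ∷ [])) (solve (a ∷ b ∷ p ∷ q ∷ r ∷ []))

  2≤r+r : 2 ≤ r + r
  2≤r+r = cancel-≤ (q + s + a + b) (wide₂ ⊕ b≤q+r ⊕ a≤r+s)
            (solve (a ∷ b ∷ q ∷ r ∷ s ∷ [])) (solve (a ∷ b ∷ q ∷ r ∷ s ∷ []))

  2≤s+s : 2 ≤ s + s
  2≤s+s = cancel-≤ (p + r + a + b) (wide₁ ⊕ a≤r+s ⊕ b≤p+s)
            (solve (a ∷ b ∷ p ∷ r ∷ s ∷ [])) (solve (a ∷ b ∷ p ∷ r ∷ s ∷ []))

shift : ∀ {a b p q r s} i j → ViolatingQuad a b p q r s →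
        p + r + (2 + i) ≤ a + b → q + s + (2 + j) ≤ a + b → 2 + b ≤ i + j + (p + s) →
        Shift a b p q r s
shift {a} {b} {p} {q} {r} {s} i j Q c₁ c₂ c₃
  with half-positive {a} (2≤a+a Q) | half-positive {p} (2≤p+p Q) | half-positive {s} (2≤s+s Q)
... | a′ , refl | p′ , refl | s′ , refl = record
  { a′ = a′ ; ρw = p′ + i ; ρx = s′ + j ; a≡1+a′ = refl
  ; q≤a′+ρw = ≤-trans q≤a′+p′ (+-monoʳ-≤ a′ (m≤m+n p′ i))
  ; r≤a′+ρx = ≤-trans r≤a′+s′ (+-monoʳ-≤ a′ (m≤m+n s′ j))
  ; b≤ρw+ρx = cancel-≤ 2 c₃ (solve vars) (solve vars)
  ; p≤1+ρw = s≤s (m≤m+n p′ i)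
  ; s≤1+ρx = s≤s (m≤m+n s′ j)
  ; wide₁′ = cancel-≤ 1 c₁ (solve vars) (solve vars)
  ; wide₂′ = cancel-≤ 1 c₂ (solve vars) (solve vars) }
  where
  open ViolatingQuad Q
  vars : List ℕ
  vars = a′ ∷ b ∷ p′ ∷ q ∷ r ∷ s′ ∷ i ∷ j ∷ []
  q≤a′+p′ : q ≤ a′ + p′
  q≤a′+p′ = cancel-≤ (suc s′ + b + 2) (wide₂ ⊕ b≤p+s) (solve vars) (solve vars)
  r≤a′+s′ : r ≤ a′ + s′
  r≤a′+s′ = cancel-≤ (p′ + b + 3) (wide₁ ⊕ b≤p+s) (solve vars) (solve vars)

-- Either a shift exists at one of the four vertices (stated for the rotated
-- quadruple starting there), or the distances are those of C4 or of the outer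
-- 4-cycle of S4.
data Outcome (a b p q r s : ℕ) : Set where
  shift-u : Shift a b p q r s → Outcome a b p q r s
  shift-w : Shift b a q r s p → Outcome a b p q r s
  shift-v : Shift a b r s p q → Outcome a b p q r s
  shift-x : Shift b a s p q r → Outcome a b p q r s
  c4-shape : a ≡ 2 → b ≡ 2 → p ≡ 1 → q ≡ 1 → r ≡ 1 → s ≡ 1 → Outcome a b p q r s
  s4-shape : a ≡ 3 → b ≡ 3 → p ≡ 2 → q ≡ 2 → r ≡ 2 → s ≡ 2 → Outcome a b p q r s

one-or-two : ∀ x → 2 ≤ x + x → x + x ≤ 4 → x ≡ 1 ⊎ x ≡ 2
one-or-two 1 _ _ = inj₁ refl
one-or-two 2 _ _ = inj₂ refl
one-or-two (suc (suc (suc x))) _ (s≤s (s≤s (s≤s h)))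
  with ≤-trans (m≤n+m (suc (suc (suc x))) x) h
... | s≤s ()

double≢3 : ∀ x → 3 ≤ x + x → x + x ≤ 3 → ⊥
double≢3 1 (s≤s (s≤s ())) _
double≢3 (suc (suc x)) _ (s≤s (s≤s h)) with ≤-trans (m≤n+m (suc (suc x)) x) h
... | s≤s ()

rigid : ∀ {a b p q r s} → ViolatingQuad a b p q r s →
        suc (a + b) ≤ p + r + 3 → suc (a + b) ≤ q + s + 3 →
        suc (p + s) ≤ 2 + b → suc (q + p) ≤ 2 + a → suc (r + q) ≤ 2 + b → suc (s + r) ≤ 2 + a →
        Outcome a b p q r s
rigid {a} {b} {p} {q} {r} {s} Q n₁ n₂ n₃ n₄ n₅ n₆ =
  cases (one-or-two p (2≤p+p Q) p+p≤4) (one-or-two q (2≤q+q Q) q+q≤4)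
        (one-or-two r (2≤r+r Q) r+r≤4) (one-or-two s (2≤s+s Q) s+s≤4)
  where
  open ViolatingQuad Q
  vars : List ℕ
  vars = a ∷ b ∷ p ∷ q ∷ r ∷ s ∷ []
  p+p≤4 : p + p ≤ 4
  p+p≤4 = cancel-≤ (q + s + a + b + 3) (n₄ ⊕ n₃ ⊕ n₂) (solve vars) (solve vars)
  q+q≤4 : q + q ≤ 4
  q+q≤4 = cancel-≤ (p + r + a + b + 3) (n₄ ⊕ n₅ ⊕ n₁) (solve vars) (solve vars)
  r+r≤4 : r + r ≤ 4
  r+r≤4 = cancel-≤ (q + s + a + b + 3) (n₅ ⊕ n₆ ⊕ n₂) (solve vars) (solve vars)
  s+s≤4 : s + s ≤ 4
  s+s≤4 = cancel-≤ (p + r + a + b + 3) (n₃ ⊕ n₆ ⊕ n₁) (solve vars) (solve vars)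
  cases : p ≡ 1 ⊎ p ≡ 2 → q ≡ 1 ⊎ q ≡ 2 → r ≡ 1 ⊎ r ≡ 2 → s ≡ 1 ⊎ s ≡ 2 → Outcome a b p q r s
  cases (inj₁ refl) (inj₁ refl) (inj₁ refl) (inj₁ refl) =
    c4-shape (≤-antisym a≤p+q (cancel-≤ (b + 2) (wide₁ ⊕ b≤p+s) (solve (a ∷ b ∷ [])) (solve (a ∷ b ∷ []))))
             (≤-antisym b≤p+s (cancel-≤ (a + 2) (wide₁ ⊕ a≤p+q) (solve (a ∷ b ∷ [])) (solve (a ∷ b ∷ []))))
             refl refl refl refl
  cases (inj₂ refl) (inj₂ refl) (inj₂ refl) (inj₂ refl) =
    s4-shape (≤-antisym (cancel-≤ (b + 6) (n₁ ⊕ n₃) (solve (a ∷ b ∷ [])) (solve (a ∷ b ∷ [])))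
                        (cancel-≤ 2 n₄ (solve (a ∷ b ∷ [])) (solve (a ∷ b ∷ []))))
             (≤-antisym (cancel-≤ (a + 6) (n₁ ⊕ n₄) (solve (a ∷ b ∷ [])) (solve (a ∷ b ∷ [])))
                        (cancel-≤ 2 n₃ (solve (a ∷ b ∷ [])) (solve (a ∷ b ∷ []))))
             refl refl refl refl
  cases (inj₁ refl) (inj₁ refl) (inj₁ refl) (inj₂ refl) = ⊥-elim (refute _ (≤-trans (s≤s wide₂) n₁))
  cases (inj₁ refl) (inj₁ refl) (inj₂ refl) (inj₁ refl) = ⊥-elim (refute _ (≤-trans (s≤s wide₁) n₂))
  cases (inj₁ refl) (inj₁ refl) (inj₂ refl) (inj₂ refl) = ⊥-elim (refute _ (≤-trans n₆ (+-monoʳ-≤ 2 a≤p+q)))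
  cases (inj₁ refl) (inj₂ refl) (inj₁ refl) (inj₁ refl) = ⊥-elim (refute _ (≤-trans (s≤s wide₂) n₁))
  cases (inj₁ refl) (inj₂ refl) (inj₁ refl) (inj₂ refl) = ⊥-elim (refute _ (≤-trans (s≤s wide₂) n₁))
  cases (inj₁ refl) (inj₂ refl) (inj₂ refl) (inj₁ refl) = ⊥-elim (refute _ (≤-trans n₅ (+-monoʳ-≤ 2 b≤p+s)))
  cases (inj₁ refl) (inj₂ refl) (inj₂ refl) (inj₂ refl) = ⊥-elim (refute _ (≤-trans (s≤s wide₂) n₁))
  cases (inj₂ refl) (inj₁ refl) (inj₁ refl) (inj₁ refl) = ⊥-elim (refute _ (≤-trans (s≤s wide₁) n₂))
  cases (inj₂ refl) (inj₁ refl) (inj₁ refl) (inj₂ refl) = ⊥-elim (refute _ (≤-trans n₃ (+-monoʳ-≤ 2 b≤q+r)))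
  cases (inj₂ refl) (inj₁ refl) (inj₂ refl) (inj₁ refl) = ⊥-elim (refute _ (≤-trans (s≤s wide₁) n₂))
  cases (inj₂ refl) (inj₁ refl) (inj₂ refl) (inj₂ refl) = ⊥-elim (refute _ (≤-trans (s≤s wide₁) n₂))
  cases (inj₂ refl) (inj₂ refl) (inj₁ refl) (inj₁ refl) = ⊥-elim (refute _ (≤-trans n₄ (+-monoʳ-≤ 2 a≤r+s)))
  cases (inj₂ refl) (inj₂ refl) (inj₁ refl) (inj₂ refl) = ⊥-elim (refute _ (≤-trans (s≤s wide₂) n₁))
  cases (inj₂ refl) (inj₂ refl) (inj₂ refl) (inj₁ refl) = ⊥-elim (refute _ (≤-trans (s≤s wide₁) n₂))

module _ {a b p q r s} (Q : ViolatingQuad a b p q r s) where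
  open ViolatingQuad Q

  -- classifyᵢⱼ handles the case where a + b exceeds p + r + 2 by exactly i and
  -- q + s + 2 by exactly j.
  private
    Q₁ : ViolatingQuad b a q r s p
    Q₁ = rotate Q
    Q₂ : ViolatingQuad a b r s p q
    Q₂ = rotate Q₁
    Q₃ : ViolatingQuad b a s p q r
    Q₃ = rotate Q₂
    vars : List ℕ
    vars = a ∷ b ∷ p ∷ q ∷ r ∷ s ∷ []

    classify₁₀ : p + r + 3 ≤ a + b → suc (a + b) ≤ q + s + 3 → suc (a + b) ≤ p + r + 4 →
                 Outcome a b p q r s
    classify₁₀ c _ n with 2 + b ≤? 1 + (p + s)
    ... | yes β = shift-u (shift 1 0 Q c wide₂ β)
    ... | no nu with 2 + a ≤? 1 + (q + p)
    ...   | yes β = shift-w (shift 0 1 Q₁ (ViolatingQuad.wide₁ Q₁)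
                       (cancel-≤ 0 c (solve vars) (solve vars)) β)
    ...   | no nw with 2 + b ≤? 1 + (r + q)
    ...     | yes β = shift-v (shift 1 0 Q₂ (cancel-≤ 0 c (solve vars) (solve vars))
                         (ViolatingQuad.wide₂ Q₂) β)
    ...     | no nv = ⊥-elim (double≢3 q
                (cancel-≤ (p + r + a + b) (c ⊕ a≤p+q ⊕ b≤q+r) (solve vars) (solve vars))
                (cancel-≤ (p + r + a + b + 5) (≰⇒> nw ⊕ ≰⇒> nv ⊕ n) (solve vars) (solve vars)))

    classify₀₁ : suc (a + b) ≤ p + r + 3 → q + s + 3 ≤ a + b → suc (a + b) ≤ q + s + 4 →
                 Outcome a b p q r s
    classify₀₁ _ c n with 2 + b ≤? 1 + (p + s)
    ... | yes β = shift-u (shift 0 1 Q wide₁ c β)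
    ... | no nu with 2 + a ≤? 1 + (q + p)
    ...   | yes β = shift-w (shift 1 0 Q₁ (cancel-≤ 0 c (solve vars) (solve vars))
                       (ViolatingQuad.wide₂ Q₁) β)
    ...   | no nw = ⊥-elim (double≢3 p
                (cancel-≤ (q + s + a + b) (c ⊕ a≤p+q ⊕ b≤p+s) (solve vars) (solve vars))
                (cancel-≤ (q + s + a + b + 5) (≰⇒> nu ⊕ ≰⇒> nw ⊕ n) (solve vars) (solve vars)))

    classify₀₀ : suc (a + b) ≤ p + r + 3 → suc (a + b) ≤ q + s + 3 → Outcome a b p q r s
    classify₀₀ n₁ n₂ with 2 + b ≤? p + s
    ... | yes β = shift-u (shift 0 0 Q wide₁ wide₂ β)
    ... | no f₁ with 2 + a ≤? q + p
    ...   | yes β = shift-w (shift 0 0 Q₁ (ViolatingQuad.wide₁ Q₁) (ViolatingQuad.wide₂ Q₁) β)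
    ...   | no f₂ with 2 + b ≤? r + q
    ...     | yes β = shift-v (shift 0 0 Q₂ (ViolatingQuad.wide₁ Q₂) (ViolatingQuad.wide₂ Q₂) β)
    ...     | no f₃ with 2 + a ≤? s + r
    ...       | yes β = shift-x (shift 0 0 Q₃ (ViolatingQuad.wide₁ Q₃) (ViolatingQuad.wide₂ Q₃) β)
    ...       | no f₄ = rigid Q n₁ n₂ (≰⇒> f₁) (≰⇒> f₂) (≰⇒> f₃) (≰⇒> f₄)

  classify : Outcome a b p q r s
  classify with p + r + 4 ≤? a + b | q + s + 4 ≤? a + b
  ... | yes c | _ = shift-u (shift 2 0 Q c wide₂ (+-monoʳ-≤ 2 b≤p+s))
  ... | no _ | yes c = shift-u (shift 0 2 Q wide₁ c (+-monoʳ-≤ 2 b≤p+s))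
  ... | no n₁ | no n₂ with p + r + 3 ≤? a + b | q + s + 3 ≤? a + b
  ...   | yes c₁ | yes c₂ = shift-u (shift 1 1 Q c₁ c₂ (+-monoʳ-≤ 2 b≤p+s))
  ...   | yes c₁ | no n₄ = classify₁₀ c₁ (≰⇒> n₄) (≰⇒> n₁)
  ...   | no n₃ | yes c₂ = classify₀₁ (≰⇒> n₃) c₂ (≰⇒> n₂)
  ...   | no n₃ | no n₄ = classify₀₀ (≰⇒> n₃) (≰⇒> n₄)

maxOver-lub : ∀ {A : Set} (xs : List A) (f : A → ℕ) {k} → (∀ x → f x ≤ k) → maxOver xs f ≤ k
maxOver-lub [] f _ = z≤n
maxOver-lub (x ∷ xs) f f≤k = ⊔-lub (f≤k x) (maxOver-lub xs f f≤k)

maxOver-upper : ∀ {A : Set} (xs : List A) (f : A → ℕ) {x} → x ∈ xs → f x ≤ maxOver xs f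
maxOver-upper (y ∷ xs) f (here refl) = m≤m⊔n (f y) _
maxOver-upper (y ∷ xs) f (there x∈xs) = ≤-trans (maxOver-upper xs f x∈xs) (m≤n⊔m (f y) _)

∈-quads : ∀ G (u v w x : V G) → (u , v , w , x) ∈ quads G
∈-quads G u v w x =
  ∈-concatMap⁺ _ (lose (∈-allFin u) (∈-concatMap⁺ _ (lose (∈-allFin v)
    (∈-concatMap⁺ _ (lose (∈-allFin w) (∈-map⁺ _ (∈-allFin x)))))))

∸-gap : ∀ x y → 2 ≤ x ∸ y → y + 2 ≤ x
∸-gap x zero h = h
∸-gap (suc x) (suc y) h = s≤s (∸-gap x y h)

Dominant : ℕ → ℕ → ℕ → Set
Dominant a b c = b + 2 ≤ a × c + 2 ≤ a

dominant⇒top2diff≥2 : ∀ {a b c} → Dominant a b c → 2 ≤ top2diff a b c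
dominant⇒top2diff≥2 {a} {b} {c} (b+2≤a , c+2≤a) = subst₂ (λ M m → 2 ≤ M ∸ m) (sym M≡a) (sym m≡b⊔c)
  (m+n≤o⇒m≤o∸n 2 (subst (_≤ a) (trans (sym (+-distribʳ-⊔ 2 b c)) (+-comm (b ⊔ c) 2)) (⊔-lub b+2≤a c+2≤a)))
  where
  b≤a : b ≤ a
  b≤a = ≤-trans (m≤m+n b 2) b+2≤a
  c≤a : c ≤ a
  c≤a = ≤-trans (m≤m+n c 2) c+2≤a
  M≡a : max3 a b c ≡ a
  M≡a = trans (cong (_⊔ c) (m≥n⇒m⊔n≡m b≤a)) (m≥n⇒m⊔n≡m c≤a)
  m≡b⊔c : median3 a b c ≡ b ⊔ c
  m≡b⊔c = cong₂ _⊔_ (m≥n⇒m⊓n≡n b≤a) (trans (cong (_⊓ c) (m≥n⇒m⊔n≡m b≤a)) (m≥n⇒m⊓n≡n c≤a))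

module _ (a b c : ℕ) (gap : 2 ≤ top2diff a b c) where
  private
    median-≥ˡ : a ⊓ b ≤ median3 a b c
    median-≥ˡ = m≤m⊔n _ _
    median-≥ʳ : (a ⊔ b) ⊓ c ≤ median3 a b c
    median-≥ʳ = m≤n⊔m _ _
    clears : ∀ {x y} → x ≤ median3 a b c → max3 a b c ≡ y → x + 2 ≤ y
    clears x≤m M≡y = ≤-trans (+-monoˡ-≤ 2 x≤m) (subst (_ ≤_) M≡y (∸-gap _ _ gap))

  top2diff≥2⇒dominant : Dominant a b c ⊎ Dominant b a c ⊎ Dominant c a b
  top2diff≥2⇒dominant with ≤-total c (a ⊔ b)
  ... | inj₂ a⊔b≤c = inj₂ (inj₂ (clears (≤-trans (m≤m⊔n a b) a⊔b≤m) M≡c ,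
                                 clears (≤-trans (m≤n⊔m a b) a⊔b≤m) M≡c))
    where
    a⊔b≤m : a ⊔ b ≤ median3 a b c
    a⊔b≤m = subst (_≤ median3 a b c) (m≤n⇒m⊓n≡m a⊔b≤c) median-≥ʳ
    M≡c : max3 a b c ≡ c
    M≡c = m≤n⇒m⊔n≡n a⊔b≤c
  ... | inj₁ c≤a⊔b with ≤-total b a
  ...   | inj₁ b≤a = inj₁ (clears (subst (_≤ median3 a b c) (m≥n⇒m⊓n≡n b≤a) median-≥ˡ) M≡a ,
                           clears c≤m M≡a)
    where
    c≤m : c ≤ median3 a b c
    c≤m = subst (_≤ median3 a b c) (m≥n⇒m⊓n≡n c≤a⊔b) median-≥ʳ
    M≡a : max3 a b c ≡ a
    M≡a = trans (m≥n⇒m⊔n≡m c≤a⊔b) (m≥n⇒m⊔n≡m b≤a)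
  ...   | inj₂ a≤b = inj₂ (inj₁ (clears (subst (_≤ median3 a b c) (m≤n⇒m⊓n≡m a≤b) median-≥ˡ) M≡b ,
                                 clears c≤m M≡b))
    where
    c≤m : c ≤ median3 a b c
    c≤m = subst (_≤ median3 a b c) (m≥n⇒m⊓n≡n c≤a⊔b) median-≥ʳ
    M≡b : max3 a b c ≡ b
    M≡b = trans (m≥n⇒m⊔n≡m c≤a⊔b) (m≤n⇒m⊔n≡n a≤b)

open All.All using ([]; _∷_)

rotate₄ : ∀ {A : Set} {P : A → Set} {a b c e} →
          All P (a ∷ b ∷ c ∷ e ∷ []) → All P (b ∷ c ∷ e ∷ a ∷ [])
rotate₄ (pa ∷ pb ∷ pc ∷ pe ∷ []) = pb ∷ pc ∷ pe ∷ pa ∷ []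

C4-dist-sym : ∀ a b → dist C4 a b ≡ dist C4 b a
C4-dist-sym = from-yes (all? λ a → all? λ b → dist C4 a b ℕₚ.≟ dist C4 b a)

S4-dist-sym : ∀ a b → dist S4 a b ≡ dist S4 b a
S4-dist-sym = from-yes (all? λ a → all? λ b → dist S4 a b ℕₚ.≟ dist S4 b a)

C4-dist≡0 : ∀ a b → dist C4 a b ≡ 0 → a ≡ b
C4-dist≡0 = from-yes (all? λ a → all? λ b → (dist C4 a b ℕₚ.≟ 0) →-dec (a ≟ b))

C4-adjacency : ∀ a b → does (dist C4 a b ℕₚ.≟ 1) ≡ c4adj a b
C4-adjacency = from-yes (all? λ a → all? λ b → does (dist C4 a b ℕₚ.≟ 1) Boolₚ.≟ c4adj a b)

outer : Fin 4 → Fin 8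
outer i = suc (suc (suc (suc i)))

S4-outer-dist≡0 : ∀ a b → dist S4 (outer a) (outer b) ≡ 0 → a ≡ b
S4-outer-dist≡0 = from-yes (all? λ a → all? λ b → (dist S4 (outer a) (outer b) ℕₚ.≟ 0) →-dec (a ≟ b))

S4-outer-square : ∀ a b → sqAdj S4 (outer a) (outer b) ≡ c4adj a b
S4-outer-square = from-yes (all? λ a → all? λ b → sqAdj S4 (outer a) (outer b) Boolₚ.≟ c4adj a b)

module HellyGraph (G : Graph) (adj-sym : ∀ u v → adj G u v ≡ adj G v u) (conn : Connected G)
                  (helly : Helly G) where
  open Metric G adj-sym conn public

  Disk : Set
  Disk = V G × ℕ

  _∈ᴰ_ : V G → Disk → Set
  z ∈ᴰ δ = D G (proj₁ δ) (proj₂ δ) z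

  Meet : Disk → Disk → Set
  Meet δ δ′ = d (proj₁ δ) (proj₁ δ′) ≤ proj₂ δ + proj₂ δ′

  meet-refl : ∀ {δ} → Meet δ δ
  meet-refl {c , ρ} = subst (_≤ ρ + ρ) (sym (dist-refl c)) z≤n

  meet-sym : ∀ {δ δ′} → Meet δ δ′ → Meet δ′ δ
  meet-sym {c , ρ} {c′ , ρ′} m = subst (d c′ c ≤_) (+-comm ρ ρ′) (flip≤ m)

  meet⇒intersect : ∀ {δ δ′} → Meet δ δ′ → ∃ λ z → z ∈ᴰ δ × z ∈ᴰ δ′
  meet⇒intersect {_ , ρ} {_ , ρ′} m with dist-split ρ ρ′ m
  ... | z , cz≤ρ , zc′≤ρ′ = z , flip≤ cz≤ρ , zc′≤ρ′

  allPairs⇒pairwise : ∀ {δs} → AllPairs Meet δs → ∀ {δ δ′} → δ ∈ δs → δ′ ∈ δs → Meet δ δ′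
  allPairs⇒pairwise {δ ∷ _} (_ ∷ _) (here refl) (here refl) = meet-refl {δ}
  allPairs⇒pairwise (m ∷ _) (here refl) (there δ′∈) = All.lookup m δ′∈
  allPairs⇒pairwise {δ ∷ _} (m ∷ _) {δ′} (there δ′∈) (here refl) = meet-sym {δ} {δ′} (All.lookup m δ′∈)
  allPairs⇒pairwise (_ ∷ ms) (there δ∈) (there δ′∈) = allPairs⇒pairwise ms δ∈ δ′∈

  helly-pairwise : ∀ δs → AllPairs Meet δs → ∃ λ z → All (z ∈ᴰ_) δs
  helly-pairwise δs ms with helly (length δs) (λ i → proj₁ (lookup δs i)) (λ i → proj₂ (lookup δs i))
                                   (λ i j → meet⇒intersect (allPairs⇒pairwise ms (∈-lookup i) (∈-lookup j)))
  ... | z , z∈ = z , All.tabulate λ δ∈ → subst (z ∈ᴰ_) (sym (lookup-index δ∈)) (z∈ (index δ∈))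

  Violating : V G → V G → V G → V G → Set
  Violating u w v x = d u w + d v x + 2 ≤ d u v + d w x × d w v + d x u + 2 ≤ d u v + d w x

  violatingQuad : ∀ {u w v x} → Violating u w v x →
                  ViolatingQuad (d u v) (d w x) (d u w) (d w v) (d v x) (d x u)
  violatingQuad {u} {w} {v} {x} (wide₁ , wide₂) = record
    { wide₁ = wide₁ ; wide₂ = wide₂
    ; b≤p+s = via w u x (dist-sym w u) (dist-sym u x)
    ; b≤q+r = dist-triangle w v x
    ; a≤p+q = dist-triangle u w v
    ; a≤r+s = subst (d u v ≤_) (+-comm (d x u) (d v x)) (via u x v (dist-sym u x) (dist-sym x v))
    ; s≤a+r = subst (d x u ≤_) (+-comm (d v x) (d u v)) (via x v u (dist-sym x v) (dist-sym v u))
    ; p≤b+s = subst (d u w ≤_) (+-comm (d x u) (d w x)) (via u x w (dist-sym u x) (dist-sym x w))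
    ; q≤a+p = subst (d w v ≤_) (+-comm (d u w) (d u v)) (via w u v (dist-sym w u) refl)
    ; r≤b+q = subst (d v x ≤_) (+-comm (d w v) (d w x)) (via v w x (dist-sym v w) refl) }
    where
    via : ∀ y z c {k l} → d y z ≡ k → d z c ≡ l → d y c ≤ k + l
    via y z c e₁ e₂ = subst (d y c ≤_) (cong₂ _+_ e₁ e₂) (dist-triangle y z c)

  shift-step : ∀ {u w v x} → Shift (d u v) (d w x) (d u w) (d w v) (d v x) (d x u) →
               ∃ λ u′ → Violating u′ w v x × d u′ v < d u v
  shift-step {u} {w} {v} {x} S = conclude (helly-pairwise disks meets)
    where
    open Shift S
    disks : List Disk
    disks = (u , 1) ∷ (v , a′) ∷ (w , ρw) ∷ (x , ρx) ∷ []
    meets : AllPairs Meet disks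
    meets = (≤-reflexive a≡1+a′ ∷ p≤1+ρw ∷ flip≤ s≤1+ρx ∷ [])
          ∷ (flip≤ q≤a′+ρw ∷ r≤a′+ρx ∷ []) ∷ (b≤ρw+ρx ∷ []) ∷ [] ∷ []
    conclude : (∃ λ z → All (z ∈ᴰ_) disks) → ∃ λ u′ → Violating u′ w v x × d u′ v < d u v
    conclude (u′ , u′u ∷ u′v ∷ u′w ∷ u′x ∷ []) = u′ , (wide₁″ , wide₂″) , closer
      where
      a′≤u′v : a′ ≤ d u′ v
      a′≤u′v = triangle-lower 1 a′ (≤-reflexive (sym a≡1+a′)) (flip≤ u′u)
      wide₁″ : d u′ w + d v x + 2 ≤ d u′ v + d w x
      wide₁″ = ≤-trans (+-monoˡ-≤ 2 (+-monoˡ-≤ (d v x) u′w))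
                       (≤-trans wide₁′ (+-monoˡ-≤ (d w x) a′≤u′v))
      wide₂″ : d w v + d x u′ + 2 ≤ d u′ v + d w x
      wide₂″ = ≤-trans (+-monoˡ-≤ 2 (+-monoʳ-≤ (d w v) (flip≤ u′x)))
                       (≤-trans wide₂′ (+-monoˡ-≤ (d w x) a′≤u′v))
      closer : d u′ v < d u v
      closer = subst (d u′ v <_) (sym a≡1+a′) (s≤s u′v)

  record Quadrangle (k : ℕ) (q₀ q₁ q₂ q₃ : V G) : Set where
    constructor quadrangle
    field
      diag₀₂ : d q₀ q₂ ≡ suc k
      diag₁₃ : d q₁ q₃ ≡ suc k
      side₀₁ : d q₀ q₁ ≡ k
      side₁₂ : d q₁ q₂ ≡ k
      side₂₃ : d q₂ q₃ ≡ k
      side₃₀ : d q₃ q₀ ≡ k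

  rotateQuadrangle : ∀ {k q₀ q₁ q₂ q₃} → Quadrangle k q₀ q₁ q₂ q₃ → Quadrangle k q₁ q₂ q₃ q₀
  rotateQuadrangle F = quadrangle diag₁₃ (flip≡ diag₀₂) side₁₂ side₂₃ side₃₀ side₀₁
    where open Quadrangle F

  quadrangle₁⇒C4 : ∀ {q₀ q₁ q₂ q₃} → Quadrangle 1 q₀ q₁ q₂ q₃ → IsometricSubgraph C4 G
  quadrangle₁⇒C4 {q₀} {q₁} {q₂} {q₃} F =
    isometric-by-pairs C4 C4-dist-sym (lookup (q₀ ∷ q₁ ∷ q₂ ∷ q₃ ∷ []))
      ((side₀₁ ∷ diag₀₂ ∷ flip≡ side₃₀ ∷ []) ∷ (side₁₂ ∷ diag₁₃ ∷ []) ∷ (side₂₃ ∷ []) ∷ [] ∷ [])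
    where open Quadrangle F

  Near : V G → V G → V G → V G → V G → Set
  Near q₀ q₁ q₂ q₃ p = All (λ q → d p q ≤ 2) (q₀ ∷ q₁ ∷ q₂ ∷ q₃ ∷ [])

  -- The hubs of the four sides of a quadrangle with sides 2 and diagonals 3 become
  -- the clique p₁, …, p₄ of an isometric S4 whose outer vertices are the corners.
  record Hub (q₀ q₁ q₂ q₃ : V G) (ps : List (V G)) : Set where
    field
      centre : V G
      to₀ : d centre q₀ ≡ 1
      to₁ : d centre q₁ ≡ 1
      to₂ : d centre q₂ ≡ 2
      to₃ : d centre q₃ ≡ 2
      close : All (λ p → d centre p ≤ 1) ps

  hub-near : ∀ {q₀ q₁ q₂ q₃ ps} (H : Hub q₀ q₁ q₂ q₃ ps) → Near q₀ q₁ q₂ q₃ (Hub.centre H)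
  hub-near H = weaken (≤-reflexive to₀) _ ∷ weaken (≤-reflexive to₁) _
             ∷ ≤-reflexive to₂ ∷ ≤-reflexive to₃ ∷ []
    where open Hub H

  hub : ∀ {q₀ q₁ q₂ q₃} → Quadrangle 2 q₀ q₁ q₂ q₃ → (ps : List (V G)) →
        All (Near q₀ q₁ q₂ q₃) ps → AllPairs (λ p p′ → d p p′ ≤ 2) ps → Hub q₀ q₁ q₂ q₃ ps
  hub {q₀} {q₁} {q₂} {q₃} F ps ps-near ps-close = conclude (helly-pairwise (corners ++ others) meets)
    where
    open Quadrangle F
    corners others : List Disk
    corners = (q₀ , 1) ∷ (q₁ , 1) ∷ (q₂ , 2) ∷ (q₃ , 2) ∷ []
    others = map (_, 1) ps
    corner-meets : AllPairs Meet corners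
    corner-meets = (≤-reflexive side₀₁ ∷ ≤-reflexive diag₀₂ ∷ weaken (≤-reflexive (flip≡ side₃₀)) _ ∷ [])
                 ∷ (weaken (≤-reflexive side₁₂) _ ∷ ≤-reflexive diag₁₃ ∷ [])
                 ∷ (weaken (≤-reflexive side₂₃) _ ∷ []) ∷ [] ∷ []
    meets-others : ∀ {q ρ} → 1 ≤ ρ → All (λ p → d p q ≤ 2) ps → All (Meet (q , ρ)) others
    meets-others 1≤ρ near = Allₚ.map⁺ (All.map (λ pq≤2 → ≤-trans (flip≤ pq≤2) (+-monoˡ-≤ 1 1≤ρ)) near)
    cross : All (λ δ → All (Meet δ) others) corners
    cross with All-swap ps-near
    ... | n₀ ∷ n₁ ∷ n₂ ∷ n₃ ∷ [] = meets-others ≤-refl n₀ ∷ meets-others ≤-refl n₁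
                                 ∷ meets-others (s≤s z≤n) n₂ ∷ meets-others (s≤s z≤n) n₃ ∷ []
    meets : AllPairs Meet (corners ++ others)
    meets = AllPairsₚ.++⁺ corner-meets (AllPairsₚ.map⁺ ps-close) cross
    conclude : (∃ λ z → All (z ∈ᴰ_) (corners ++ others)) → Hub q₀ q₁ q₂ q₃ ps
    conclude (z , z∈) with ++⁻ corners z∈
    ... | z₀ ∷ z₁ ∷ z₂ ∷ z₃ ∷ [] , z∈others = record
      { centre = z
      ; to₀ = ≤-antisym z₀ (triangle-lower 2 1 (≤-reflexive (sym (flip≡ diag₀₂))) (flip≤ z₂))
      ; to₁ = ≤-antisym z₁ (triangle-lower 2 1 (≤-reflexive (sym (flip≡ diag₁₃))) (flip≤ z₃))
      ; to₂ = ≤-antisym z₂ (triangle-lower 1 2 (≤-reflexive (sym diag₀₂)) (flip≤ z₀))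
      ; to₃ = ≤-antisym z₃ (triangle-lower 1 2 (≤-reflexive (sym diag₁₃)) (flip≤ z₁))
      ; close = Allₚ.map⁻ z∈others }

  adjacent-by-witness : ∀ {a b q} → d a q ≡ 2 → d b q ≡ 1 → d b a ≤ 1 → d a b ≡ 1
  adjacent-by-witness aq bq ba≤1 =
    flip≡ (≤-antisym ba≤1 (triangle-lower 1 1 (≤-reflexive (sym (flip≡ aq))) (≤-reflexive (flip≡ bq))))

  quadrangle₂⇒S4 : ∀ {q₀ q₁ q₂ q₃} → Quadrangle 2 q₀ q₁ q₂ q₃ → IsometricSubgraph S4 G
  quadrangle₂⇒S4 {q₀} {q₁} {q₂} {q₃} F₀ =
    isometric-by-pairs S4 S4-dist-sym (lookup (h₁ ∷ h₂ ∷ h₃ ∷ h₄ ∷ q₀ ∷ q₁ ∷ q₂ ∷ q₃ ∷ []))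
      ( (h₁h₂ ∷ h₁h₃ ∷ h₁h₄ ∷ Hub.to₁ H₁ ∷ Hub.to₂ H₁ ∷ Hub.to₃ H₁ ∷ Hub.to₀ H₁ ∷ [])
      ∷ (h₂h₃ ∷ h₂h₄ ∷ Hub.to₀ H₂ ∷ Hub.to₁ H₂ ∷ Hub.to₂ H₂ ∷ Hub.to₃ H₂ ∷ [])
      ∷ (h₃h₄ ∷ Hub.to₃ H₃ ∷ Hub.to₀ H₃ ∷ Hub.to₁ H₃ ∷ Hub.to₂ H₃ ∷ [])
      ∷ (Hub.to₂ H₄ ∷ Hub.to₃ H₄ ∷ Hub.to₀ H₄ ∷ Hub.to₁ H₄ ∷ [])
      ∷ (side₀₁ ∷ diag₀₂ ∷ flip≡ side₃₀ ∷ []) ∷ (side₁₂ ∷ diag₁₃ ∷ []) ∷ (side₂₃ ∷ []) ∷ [] ∷ [])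
    where
    open Quadrangle F₀
    F₁ : Quadrangle 2 q₁ q₂ q₃ q₀
    F₁ = rotateQuadrangle F₀
    F₂ : Quadrangle 2 q₂ q₃ q₀ q₁
    F₂ = rotateQuadrangle F₁
    F₃ : Quadrangle 2 q₃ q₀ q₁ q₂
    F₃ = rotateQuadrangle F₂
    weaken-close : ∀ {a b} → d a b ≤ 1 → d b a ≤ 2
    weaken-close ab≤1 = weaken (flip≤ ab≤1) _
    H₁ : Hub q₃ q₀ q₁ q₂ []
    H₁ = hub F₃ [] [] []
    h₁ : V G
    h₁ = Hub.centre H₁
    H₂ : Hub q₀ q₁ q₂ q₃ (h₁ ∷ [])
    H₂ = hub F₀ _ (rotate₄ (hub-near H₁) ∷ []) ([] ∷ [])
    h₂ : V G
    h₂ = Hub.centre H₂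
    H₃ : Hub q₁ q₂ q₃ q₀ (h₁ ∷ h₂ ∷ [])
    H₃ = hub F₁ _ (rotate₄ (rotate₄ (hub-near H₁)) ∷ rotate₄ (hub-near H₂) ∷ [])
                  ((weaken-close (All.head (Hub.close H₂)) ∷ []) ∷ [] ∷ [])
    h₃ : V G
    h₃ = Hub.centre H₃
    H₄ : Hub q₂ q₃ q₀ q₁ (h₁ ∷ h₂ ∷ h₃ ∷ [])
    H₄ = hub F₂ _ (rotate₄ (rotate₄ (rotate₄ (hub-near H₁))) ∷ rotate₄ (rotate₄ (hub-near H₂))
                   ∷ rotate₄ (hub-near H₃) ∷ [])
                  ( (weaken-close (All.head (Hub.close H₂)) ∷ weaken-close (All.head (Hub.close H₃)) ∷ [])
                  ∷ (weaken-close (All.head (All.tail (Hub.close H₃))) ∷ []) ∷ [] ∷ [])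
    h₄ : V G
    h₄ = Hub.centre H₄
    h₁h₂ : d h₁ h₂ ≡ 1
    h₁h₂ = adjacent-by-witness (Hub.to₂ H₁) (Hub.to₁ H₂) (All.head (Hub.close H₂))
    h₁h₃ : d h₁ h₃ ≡ 1
    h₁h₃ = adjacent-by-witness (Hub.to₂ H₁) (Hub.to₀ H₃) (All.head (Hub.close H₃))
    h₁h₄ : d h₁ h₄ ≡ 1
    h₁h₄ = adjacent-by-witness (Hub.to₃ H₁) (Hub.to₀ H₄) (All.head (Hub.close H₄))
    h₂h₃ : d h₂ h₃ ≡ 1
    h₂h₃ = adjacent-by-witness (Hub.to₂ H₂) (Hub.to₁ H₃) (All.head (All.tail (Hub.close H₃)))
    h₂h₄ : d h₂ h₄ ≡ 1
    h₂h₄ = adjacent-by-witness (Hub.to₂ H₂) (Hub.to₀ H₄) (All.head (All.tail (Hub.close H₄)))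
    h₃h₄ : d h₃ h₄ ≡ 1
    h₃h₄ = adjacent-by-witness (Hub.to₂ H₃) (Hub.to₁ H₄) (All.head (All.tail (All.tail (Hub.close H₄))))

  C4⊎S4 : Set
  C4⊎S4 = IsometricSubgraph C4 G ⊎ IsometricSubgraph S4 G

  Bounded : ℕ → Set
  Bounded N = ∀ {u w v x} → d u v + d w x ≤ N → Violating u w v x → C4⊎S4

  descend : ∀ {N u w v x} → Bounded N → d u v + d w x ≤ suc N →
            (∃ λ u′ → Violating u′ w v x × d u′ v < d u v) → C4⊎S4
  descend {w = w} {x = x} rec le (u′ , V′ , closer) =
    rec (≤-pred (≤-trans (+-monoˡ-< (d w x) closer) le)) V′

  dispatch : ∀ {N u w v x} → Bounded N → d u v + d w x ≤ suc N →
             Outcome (d u v) (d w x) (d u w) (d w v) (d v x) (d x u) → C4⊎S4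
  dispatch rec le (shift-u S) = descend rec le (shift-step S)
  dispatch {N} {u} {w} {v} {x} rec le (shift-w S) = descend rec (subst (_≤ suc N) measure le)
                      (shift-step (subst (λ t → Shift _ t _ _ _ _) (dist-sym u v) S))
    where
    measure : d u v + d w x ≡ d w x + d v u
    measure = trans (+-comm (d u v) (d w x)) (cong (d w x +_) (dist-sym u v))
  dispatch {N} {u} {w} {v} {x} rec le (shift-v S) = descend rec (subst (_≤ suc N) measure le)
                      (shift-step (subst₂ (λ t t′ → Shift t t′ _ _ _ _) (dist-sym u v) (dist-sym w x) S))
    where
    measure : d u v + d w x ≡ d v u + d x w
    measure = cong₂ _+_ (dist-sym u v) (dist-sym w x)
  dispatch {N} {u} {w} {v} {x} rec le (shift-x S) = descend rec (subst (_≤ suc N) measure le)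
                      (shift-step (subst (λ t → Shift t _ _ _ _ _) (dist-sym w x) S))
    where
    measure : d u v + d w x ≡ d x w + d u v
    measure = trans (+-comm (d u v) (d w x)) (cong (_+ d u v) (dist-sym w x))
  dispatch _ _ (c4-shape a b p q r s) = inj₁ (quadrangle₁⇒C4 (quadrangle a b p q r s))
  dispatch _ _ (s4-shape a b p q r s) = inj₂ (quadrangle₂⇒S4 (quadrangle a b p q r s))

  violating⇒C4⊎S4 : ∀ N → Bounded N
  violating⇒C4⊎S4 zero le (wide₁ , _) = ⊥-elim (refute _ (≤-trans (m≤n+m 2 _) (≤-trans wide₁ le)))
  violating⇒C4⊎S4 (suc N) le V = dispatch (violating⇒C4⊎S4 N) le (classify (violatingQuad V))

module HellyCharacterisation (G : Graph) (adj-sym : ∀ u v → adj G u v ≡ adj G v u)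
                             (adj-irrefl : ∀ u → adj G u u ≡ false) (conn : Connected G)
                             (helly : Helly G) where
  open HellyGraph G adj-sym conn helly

  HasViolating : Set
  HasViolating = ∃ λ u → ∃ λ w → ∃ λ v → ∃ λ x → Violating u w v x

  rearrange : ∀ {m m′ S} → m ≡ m′ → m + 2 ≤ S → m′ + 2 ≤ S
  rearrange {S = S} = subst (λ t → t + 2 ≤ S)

  flip-sum : ∀ a b c e → d a b + d c e ≡ d e c + d b a
  flip-sum a b c e = trans (+-comm (d a b) (d c e)) (cong₂ _+_ (dist-sym c e) (dist-sym a b))

  violating⇒top2diff≥2 : ∀ {u w v x} → Violating u w v x →
                          2 ≤ top2diff (d u v + d w x) (d u w + d v x) (d u x + d v w)
  violating⇒top2diff≥2 {u} {w} {v} {x} (wide₁ , wide₂) =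
    dominant⇒top2diff≥2 (wide₁ , rearrange (flip-sum w v x u) wide₂)

  half-hyperbolic⇔no-violating : HalfHyperbolic G ⇔ (¬ HasViolating)
  half-hyperbolic⇔no-violating = mk⇔
    (λ { hb≤1 (u , w , v , x , V) → refute _ (≤-trans (violating⇒top2diff≥2 V)
           (≤-trans (maxOver-upper (quads G) _ (∈-quads G u v w x)) hb≤1)) })
    (λ none → maxOver-lub (quads G) _ λ { (u , v , w , x) → gap≤1 none u v w x })
    where
    gap≤1 : ¬ HasViolating → ∀ u v w x →
            top2diff (d u v + d w x) (d u w + d v x) (d u x + d v w) ≤ 1
    gap≤1 none u v w x with top2diff (d u v + d w x) (d u w + d v x) (d u x + d v w) ≤? 1
    ... | yes gap≤1 = gap≤1
    ... | no gap≰1 with top2diff≥2⇒dominant _ _ _ (≰⇒> gap≰1)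
    ...   | inj₁ (h₁ , h₂) = ⊥-elim (none (u , w , v , x , h₁ , rearrange (flip-sum u x v w) h₂))
    ...   | inj₂ (inj₁ (h₁ , h₂)) = ⊥-elim (none (u , v , w , x , h₁ ,
              rearrange (trans (+-comm (d u x) (d v w)) (cong (d v w +_) (dist-sym u x))) h₂))
    ...   | inj₂ (inj₂ (h₁ , h₂)) = ⊥-elim (none (u , v , x , w ,
              subst (λ t → d u v + t + 2 ≤ d u x + d v w) (dist-sym w x) h₁ ,
              rearrange (trans (+-comm (d u w) (d v x)) (cong (d v x +_) (dist-sym u w))) h₂))

  short-sides⇒violating : ∀ k {u w v x} → d u w ≤ k → d w v ≤ k → d v x ≤ k → d x u ≤ k →
                          suc k ≤ d u v → suc k ≤ d w x → Violating u w v x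
  short-sides⇒violating k {u} {w} {v} {x} uw wv vx xu uv wx =
    ≤-trans (+-monoˡ-≤ 2 (uw ⊕ vx)) diagonals , ≤-trans (+-monoˡ-≤ 2 (wv ⊕ xu)) diagonals
    where
    diagonals : k + k + 2 ≤ d u v + d w x
    diagonals = subst (_≤ d u v + d w x) (trans (cong suc (+-suc k k)) (+-comm 2 (k + k))) (uv ⊕ wx)

  C4⇒violating : IsometricSubgraph C4 G → HasViolating
  C4⇒violating (φ , iso) = _ , _ , _ , _ , short-sides⇒violating 1
    (≤-reflexive (iso (# 0) (# 1))) (≤-reflexive (iso (# 1) (# 2)))
    (≤-reflexive (iso (# 2) (# 3))) (≤-reflexive (iso (# 3) (# 0)))
    (≤-reflexive (sym (iso (# 0) (# 2)))) (≤-reflexive (sym (iso (# 1) (# 3))))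

  S4⇒violating : IsometricSubgraph S4 G → HasViolating
  S4⇒violating (φ , iso) = _ , _ , _ , _ , short-sides⇒violating 2
    (≤-reflexive (iso (# 4) (# 5))) (≤-reflexive (iso (# 5) (# 6)))
    (≤-reflexive (iso (# 6) (# 7))) (≤-reflexive (iso (# 7) (# 4)))
    (≤-reflexive (sym (iso (# 4) (# 6)))) (≤-reflexive (sym (iso (# 5) (# 7))))

  no-C4-S4⇒half-hyperbolic : ¬ IsometricSubgraph C4 G → ¬ IsometricSubgraph S4 G → HalfHyperbolic G
  no-C4-S4⇒half-hyperbolic ¬C4 ¬S4 = Equivalence.from half-hyperbolic⇔no-violating
    λ (_ , _ , _ , _ , V) → [ ¬C4 , ¬S4 ] (violating⇒C4⊎S4 _ ≤-refl V)

  nonadjacent⇒dist≥2 : ∀ {a b} → adj G a b ≡ false → a ≢ b → 2 ≤ d a b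
  nonadjacent⇒dist≥2 {a} {b} ab a≢b with d a b in e
  ... | 0 = ⊥-elim (a≢b (dist≡0⇒≡ e))
  ... | 1 = ⊥-elim (case trans (sym ab) (dist≡1⇒adj e) of λ ())
  ... | suc (suc _) = s≤s (s≤s z≤n)

  square-adjacent⇒dist≤2 : ∀ {a b} → sqAdj G a b ≡ true → d a b ≤ 2
  square-adjacent⇒dist≤2 {a} {b} e = ≤ᵇ⇒≤ (d a b) 2 (proj₂ (Equivalence.to T-∧ (Equivalence.from T-≡ e)))

  square-nonadjacent⇒dist≥3 : ∀ {a b} → sqAdj G a b ≡ false → a ≢ b → 3 ≤ d a b
  square-nonadjacent⇒dist≥3 {a} {b} e a≢b with d a b ≤? 2
  ... | no ab≰2 = ≰⇒> ab≰2
  ... | yes ab≤2 = ⊥-elim (case trans (sym e) (cong₂ _∧_ (dec-true (1 ≤? d a b) 1≤ab)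
                                                      (dec-true (d a b ≤? 2) ab≤2)) of λ ())
    where
    1≤ab : 1 ≤ d a b
    1≤ab = n≢0⇒n>0 (a≢b ∘ dist≡0⇒≡)

  inducedC4⇒violating : HasInducedC4 (adj G) → HasViolating
  inducedC4⇒violating (φ , inj , e) = _ , _ , _ , _ , short-sides⇒violating 1
    (adj⇒dist≤1 (e (# 0) (# 1))) (adj⇒dist≤1 (e (# 1) (# 2)))
    (adj⇒dist≤1 (e (# 2) (# 3))) (adj⇒dist≤1 (e (# 3) (# 0)))
    (nonadjacent⇒dist≥2 (e (# 0) (# 2)) (λ eq → case inj (# 0) (# 2) eq of λ ()))
    (nonadjacent⇒dist≥2 (e (# 1) (# 3)) (λ eq → case inj (# 1) (# 3) eq of λ ()))

  square-inducedC4⇒violating : HasInducedC4 (sqAdj G) → HasViolating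
  square-inducedC4⇒violating (φ , inj , e) = _ , _ , _ , _ , short-sides⇒violating 2
    (square-adjacent⇒dist≤2 (e (# 0) (# 1))) (square-adjacent⇒dist≤2 (e (# 1) (# 2)))
    (square-adjacent⇒dist≤2 (e (# 2) (# 3))) (square-adjacent⇒dist≤2 (e (# 3) (# 0)))
    (square-nonadjacent⇒dist≥3 (e (# 0) (# 2)) (λ eq → case inj (# 0) (# 2) eq of λ ()))
    (square-nonadjacent⇒dist≥3 (e (# 1) (# 3)) (λ eq → case inj (# 1) (# 3) eq of λ ()))

  adj≡dist≟1 : ∀ a b → adj G a b ≡ does (d a b ℕₚ.≟ 1)
  adj≡dist≟1 a b with adj G a b in ab
  ... | true = sym (dec-true (d a b ℕₚ.≟ 1) (≤-antisym (adj⇒dist≤1 ab) (n≢0⇒n>0 (a≢b ∘ dist≡0⇒≡))))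
    where
    a≢b : a ≢ b
    a≢b refl = case trans (sym ab) (adj-irrefl a) of λ ()
  ... | false = sym (dec-false (d a b ℕₚ.≟ 1) λ ab≡1 → case trans (sym ab) (dist≡1⇒adj ab≡1) of λ ())

  isometric-collapse : ∀ {H} ((φ , _) : IsometricSubgraph H G) {a b} → φ a ≡ φ b → dist H a b ≡ 0
  isometric-collapse (φ , iso) {a} {b} eq =
    trans (sym (iso a b)) (trans (cong (d (φ a)) (sym eq)) (dist-refl (φ a)))

  C4⇒inducedC4 : IsometricSubgraph C4 G → HasInducedC4 (adj G)
  C4⇒inducedC4 I@(φ , iso) = φ ,
    (λ a b eq → C4-dist≡0 a b (isometric-collapse {C4} I {a} {b} eq)) ,
    λ a b → trans (adj≡dist≟1 (φ a) (φ b))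
                  (trans (cong (λ t → does (t ℕₚ.≟ 1)) (iso a b)) (C4-adjacency a b))

  square-cong : ∀ {H x y a b} → d x y ≡ dist H a b → sqAdj G x y ≡ sqAdj H a b
  square-cong e = cong (λ t → does (1 ≤? t) ∧ does (t ≤? 2)) e

  S4⇒square-inducedC4 : IsometricSubgraph S4 G → HasInducedC4 (sqAdj G)
  S4⇒square-inducedC4 I@(φ , iso) = φ ∘ outer ,
    (λ a b eq → S4-outer-dist≡0 a b (isometric-collapse {S4} I {outer a} {outer b} eq)) ,
    λ a b → trans (square-cong {S4} {φ (outer a)} {φ (outer b)} {outer a} {outer b}
                                (iso (outer a) (outer b)))
                  (S4-outer-square a b)

  if-≤ : ∀ c {m k} → (T c → m ≤ k) → (if c then m else 0) ≤ k
  if-≤ true h = h _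
  if-≤ false _ = z≤n

  half-hyperbolic⇒tau≤1 : HalfHyperbolic G → tau G ≤ 1
  half-hyperbolic⇒tau≤1 hb≤1 = maxOver-lub (quads G) _ λ { (x , y , u , v) → if-≤ _ (slice-close x y u v) }
    where
    slice-close : ∀ x y u v →
      T (does (d x u + d u y ℕₚ.≟ d x y) ∧ does (d x v + d v y ℕₚ.≟ d x y) ∧ does (d x u ℕₚ.≟ d x v)) →
      d u v ≤ 1
    slice-close x y u v t with Equivalence.to T-∧ t
    ... | t₁ , t₂₃ with Equivalence.to T-∧ t₂₃
    ...   | t₂ , t₃ with d u v ≤? 1
    ...     | yes uv≤1 = uv≤1
    ...     | no uv≰1 =
      ⊥-elim (Equivalence.to half-hyperbolic⇔no-violating hb≤1 (x , u , y , v , wide₁ , wide₂))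
      where
      xu+uy : d x u + d u y ≡ d x y
      xu+uy = ≡ᵇ⇒≡ _ _ t₁
      xv+vy : d x v + d v y ≡ d x y
      xv+vy = ≡ᵇ⇒≡ _ _ t₂
      xu≡xv : d x u ≡ d x v
      xu≡xv = ≡ᵇ⇒≡ _ _ t₃
      2+xy≤ : d x y + 2 ≤ d x y + d u v
      2+xy≤ = +-monoʳ-≤ (d x y) (≰⇒> uv≰1)
      wide₁ : d x u + d y v + 2 ≤ d x y + d u v
      wide₁ = subst (λ t → t + 2 ≤ d x y + d u v) (sym (trans (cong₂ _+_ xu≡xv (dist-sym y v)) xv+vy)) 2+xy≤
      wide₂ : d u y + d v x + 2 ≤ d x y + d u v
      wide₂ = subst (λ t → t + 2 ≤ d x y + d u v) (sym uy+vx) 2+xy≤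
        where
        uy+vx : d u y + d v x ≡ d x y
        uy+vx = begin
          d u y + d v x  ≡⟨ +-comm (d u y) (d v x) ⟩
          d v x + d u y  ≡⟨ cong (_+ d u y) (trans (dist-sym v x) (sym xu≡xv)) ⟩
          d x u + d u y  ≡⟨ xu+uy ⟩
          d x y          ∎

  if-≥ : ∀ {c m k} → T c → k ≤ m → k ≤ (if c then m else 0)
  if-≥ {true} _ k≤m = k≤m

  C4⇒tau≥2 : IsometricSubgraph C4 G → 2 ≤ tau G
  C4⇒tau≥2 (φ , iso) = ≤-trans (if-≥ same-slice (≤-reflexive (sym (iso (# 1) (# 3)))))
    (maxOver-upper (quads G) _ (∈-quads G (φ (# 0)) (φ (# 2)) (φ (# 1)) (φ (# 3))))
    where
    same-slice : T (does (d (φ (# 0)) (φ (# 1)) + d (φ (# 1)) (φ (# 2)) ℕₚ.≟ d (φ (# 0)) (φ (# 2)))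
                  ∧ does (d (φ (# 0)) (φ (# 3)) + d (φ (# 3)) (φ (# 2)) ℕₚ.≟ d (φ (# 0)) (φ (# 2)))
                  ∧ does (d (φ (# 0)) (φ (# 1)) ℕₚ.≟ d (φ (# 0)) (φ (# 3))))
    same-slice = Equivalence.from T-∧
      ( ≡⇒≡ᵇ _ _ (trans (cong₂ _+_ (iso (# 0) (# 1)) (iso (# 1) (# 2))) (sym (iso (# 0) (# 2))))
      , Equivalence.from T-∧
        ( ≡⇒≡ᵇ _ _ (trans (cong₂ _+_ (iso (# 0) (# 3)) (iso (# 3) (# 2))) (sym (iso (# 0) (# 2))))
        , ≡⇒≡ᵇ _ _ (trans (iso (# 0) (# 1)) (sym (iso (# 0) (# 3))))))

corollary4 : (G : Graph) → Simple G → Connected G → Helly G →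
    (HalfHyperbolic G ⇔ (¬ IsometricSubgraph C4 G × ¬ IsometricSubgraph S4 G))
    × (HalfHyperbolic G ⇔ (¬ HasInducedC4 (adj G) × ¬ HasInducedC4 (sqAdj G)))
    × (HalfHyperbolic G ⇔ (tau G ≤ 1 × ¬ IsometricSubgraph S4 G))
corollary4 G (adj-sym , adj-irrefl) conn helly =
    mk⇔ (λ hb → excludes hb ∘ C4⇒violating , excludes hb ∘ S4⇒violating)
        (λ (¬C4 , ¬S4) → no-C4-S4⇒half-hyperbolic ¬C4 ¬S4)
  , mk⇔ (λ hb → excludes hb ∘ inducedC4⇒violating , excludes hb ∘ square-inducedC4⇒violating)
        (λ (¬C4 , ¬C4²) → no-C4-S4⇒half-hyperbolic (¬C4 ∘ C4⇒inducedC4) (¬C4² ∘ S4⇒square-inducedC4))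
  , mk⇔ (λ hb → half-hyperbolic⇒tau≤1 hb , excludes hb ∘ S4⇒violating)
        (λ (tau≤1 , ¬S4) → no-C4-S4⇒half-hyperbolic (λ C → refute _ (≤-trans (C4⇒tau≥2 C) tau≤1)) ¬S4)
  where
  open HellyCharacterisation G adj-sym adj-irrefl conn helly
  excludes : HalfHyperbolic G → ¬ HasViolating
  excludes = Equivalence.to half-hyperbolic⇔no-violating
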